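{- Let $k\ge 3$ and let $\alpha\ge 0$ be an integer. If $d>\alpha(q^2+q)-q$, then any $[n,k,d]_q$ A$^s$MDS code satisfies \[ n\le (s+1-\alpha)(q+1)+k-2+\alpha. \] In particular, if $d>q^2$ then $n\le s(q+1)+k-1$.
   Context: A linear $[n,k,d]_q$ code is identified with a projective system: a finite multiset $\mathcal{G}$ of $n$ points (counted with multiplicity) of $\mathrm{PG}(k-1,q)$, not all lying in one hyperplane, with $n-d=\max_H|\mathcal{G}\cap H|$ over hyperplanes $H$ (counted with multiplicity). The Singleton defect is $n-k+1-d$; the code is A$^s$MDS if its defect is $s$. -}

module Defs where

open import Level using (Level; _⊔_) renaming (suc to lsuc)
open import Algebra.Bundles using (CommutativeRing)
open import Data.Nat using (ℕ; zero; suc; _≤_)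
open import Data.Fin using (Fin)
open import Data.List using (List; length)
open import Data.List.Relation.Unary.Any using (Any)
open import Data.List.Relation.Unary.AllPairs using (AllPairs)
open import Data.Product using (Σ; _×_; ∃)
open import Relation.Binary using (Decidable)
open import Relation.Binary.PropositionalEquality using (_≡_)
open import Relation.Nullary using (¬_; Dec; yes; no)

record FiniteField (c ℓ : Level) : Set (lsuc (c ⊔ ℓ)) where
  field
    commRing : CommutativeRing c ℓ
  open CommutativeRing commRing public
  field
    _≟_      : Decidable _≈_
    0≉1      : ¬ (0# ≈ 1#)
    inverse  : ∀ x → ¬ (x ≈ 0#) → Σ Carrier (λ y → (x * y) ≈ 1#)
    elements : List Carrier
    complete : ∀ x → Any (x ≈_) elements
    distinct : AllPairs (λ x y → ¬ (x ≈ y)) elements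

  order : ℕ
  order = length elements

count : ∀ {p} (n : ℕ) {P : Fin n → Set p} → (∀ i → Dec (P i)) → ℕ
count zero    P? = 0
count (suc n) P? with P? Fin.zero
... | yes _ = suc (count n (λ i → P? (Fin.suc i)))
... | no  _ = count n (λ i → P? (Fin.suc i))

module CodeDefs {c ℓ} (F : FiniteField c ℓ) where
  open FiniteField F

  Vec : ℕ → Set c
  Vec k = Fin k → Carrier

  IsZero : ∀ {k} → Vec k → Set ℓ
  IsZero u = ∀ j → u j ≈ 0#

  dot : ∀ k → Vec k → Vec k → Carrier
  dot zero    u v = 0#
  dot (suc k) u v = (u Fin.zero * v Fin.zero) + dot k (λ j → u (Fin.suc j)) (λ j → v (Fin.suc j))

  -- A projective system of n points in PG(k-1,q), given by representative
  -- (non-zero) vectors g i ∈ F^k (repetitions allowed = multiset).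
  -- Hyperplanes of PG(k-1,q) are the kernels of non-zero linear forms u.
  record ProjectiveSystem (n k : ℕ) : Set (c ⊔ ℓ) where
    field
      point        : Fin n → Vec k
      pointNonzero : ∀ i → ¬ IsZero (point i)
      spanning     : ∀ (u : Vec k) → ¬ IsZero u → Σ (Fin n) (λ i → ¬ (dot k u (point i) ≈ 0#))

    meet : Vec k → ℕ
    meet u = count n (λ i → dot k u (point i) ≟ 0#)

  -- the [n,k,d]_q code given by the projective system has minimum distance d,
  -- i.e. n - d = max_H |G ∩ H|.  Stated additively: n = d + max.
  HasMinDistance : ∀ {n k} → ProjectiveSystem n k → ℕ → Set (c ⊔ ℓ)
  HasMinDistance {n} {k} G d =
    (∀ (u : Vec k) → ¬ IsZero u → d Data.Nat.+ ProjectiveSystem.meet G u ≤ n)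
    × ∃ (λ (u : Vec k) → (¬ IsZero u) × (d Data.Nat.+ ProjectiveSystem.meet G u ≡ n))

{-# OPTIONS --safe #-}
module Submission where

-- Let H be a hyperplane carrying the maximal number M₁ = n − d of points, S ⊂ H a codimension-2
-- subspace carrying the most points M₂ among those in H, and T ⊂ S a codimension-3 subspace through
-- min(k − 3, M₂) points of S. Counting the points of G on the q + 1 hyperplanes through S gives
-- n + q M₂ ≤ (q + 1) M₁, and counting the points of G ∩ H on the q + 1 hyperplanes of H through T
-- gives M₁ + q M₃ ≤ (q + 1) M₂ (maximality of S). Hence M₃ < M₂ < M₁, so M₃ ≥ k − 3, and with
-- A = M₁ − M₂ and B = M₂ − (k − 3) the two counts read d ≤ q A and A ≤ q B. The hypothesis on d
-- then forces B ≥ α + 1, that is q M₁ ≥ d + q (k − 2 + α), which is the claimed bound on n = d + M₁.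

open import Defs

module Counting where

  open import Data.Nat
  open import Data.Nat.Properties
  open import Data.Fin as Fin using (Fin; zero; suc)
  open import Data.List using (List; []; _∷_; length; map)
  open import Data.List.Properties using (length-map; length-removeAt)
  open import Data.List.Relation.Unary.Any as Any using (Any; _─_)
  open import Data.List.Relation.Unary.All using (All; _∷_)
  open import Data.List.Relation.Unary.All.Properties using (map⁻)
  open import Data.Bool using (if_then_else_)
  open import Data.Product using (∃; _×_; _,_)
  open import Data.Empty using (⊥)
  open import Function using (_∘_; _⇔_)
  open import Relation.Nullary using (¬_; Dec; does; yes; no; contradiction)
  open import Relation.Nullary.Decidable using (does-⇔; dec-true; dec-false)
  open import Relation.Binary.PropositionalEquality
  open import Algebra.Properties.Semiring.Sum +-*-semiring public
    using (sum; sum-syntax; sum-cong-≗; ∑-comm; ∑-distrib-+; *-distribˡ-sum)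

  length-─ : ∀ {a p} {A : Set a} {P : A → Set p} {xs : List A} (p : Any P xs) →
             suc (length (xs ─ p)) ≡ length xs
  length-─ {xs = x ∷ xs} p = cong suc (length-removeAt (x ∷ xs) (Any.index p))

  𝟙 : ∀ {p} {P : Set p} → Dec P → ℕ
  𝟙 P? = if does P? then 1 else 0

  𝟙-cong : ∀ {p q} {P : Set p} {Q : Set q} → P ⇔ Q → (P? : Dec P) (Q? : Dec Q) → 𝟙 P? ≡ 𝟙 Q?
  𝟙-cong P⇔Q P? Q? = cong (if_then 1 else 0) (does-⇔ P⇔Q P? Q?)

  𝟙-yes : ∀ {p} {P : Set p} (P? : Dec P) → P → 𝟙 P? ≡ 1
  𝟙-yes P? p = cong (if_then 1 else 0) (dec-true P? p)

  𝟙-no : ∀ {p} {P : Set p} (P? : Dec P) → ¬ P → 𝟙 P? ≡ 0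
  𝟙-no P? ¬p = cong (if_then 1 else 0) (dec-false P? ¬p)

  𝟙≤1 : ∀ {p} {P : Set p} (P? : Dec P) → 𝟙 P? ≤ 1
  𝟙≤1 (yes _) = ≤-refl
  𝟙≤1 (no _)  = z≤n

  count≡∑𝟙 : ∀ {p} n {P : Fin n → Set p} (P? : ∀ i → Dec (P i)) → count n P? ≡ ∑[ i < n ] 𝟙 (P? i)
  count≡∑𝟙 zero    P? = refl
  count≡∑𝟙 (suc n) P? with P? zero
  ... | yes _ = cong suc (count≡∑𝟙 n (P? ∘ suc))
  ... | no _  = count≡∑𝟙 n (P? ∘ suc)

  count≤n : ∀ {p} n {P : Fin n → Set p} (P? : ∀ i → Dec (P i)) → count n P? ≤ n
  count≤n zero    P? = z≤n
  count≤n (suc n) P? with P? zero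
  ... | yes _ = s≤s (count≤n n (P? ∘ suc))
  ... | no _  = m≤n⇒m≤1+n (count≤n n (P? ∘ suc))

  count<n : ∀ {p} n {P : Fin n → Set p} (P? : ∀ i → Dec (P i)) (i : Fin n) → ¬ P i → count n P? < n
  count<n (suc n) P? i ¬p with P? zero | i
  ... | yes p | zero  = contradiction p ¬p
  ... | no _  | zero  = s≤s (count≤n n (P? ∘ suc))
  ... | yes _ | suc i = s≤s (count<n n (P? ∘ suc) i ¬p)
  ... | no _  | suc i = m≤n⇒m≤1+n (count<n n (P? ∘ suc) i ¬p)

  ∑-const : ∀ n c → ∑[ i < n ] c ≡ n * c
  ∑-const zero    c = refl
  ∑-const (suc n) c = cong (c +_) (∑-const n c)

  ∑-mono-≤ : ∀ {n} {f g : Fin n → ℕ} → (∀ i → f i ≤ g i) → sum f ≤ sum g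
  ∑-mono-≤ {zero}  f≤g = z≤n
  ∑-mono-≤ {suc n} f≤g = +-mono-≤ (f≤g zero) (∑-mono-≤ (f≤g ∘ suc))

  ∑-bounded : ∀ {n} {f : Fin n → ℕ} {c} → (∀ i → f i ≤ c) → sum f ≤ n * c
  ∑-bounded {n} {c = c} f≤c = ≤-trans (∑-mono-≤ f≤c) (≤-reflexive (∑-const n c))

  firstSupport : ∀ {n} → ℕ → (Fin n → ℕ) → List (Fin n)
  firstSupport {zero}  r       σ = []
  firstSupport {suc n} zero    σ = []
  firstSupport {suc n} (suc r) σ with σ zero
  ... | zero  = map suc (firstSupport (suc r) (σ ∘ suc))
  ... | suc _ = zero ∷ map suc (firstSupport r (σ ∘ suc))

  length-firstSupport : ∀ {n} r (σ : Fin n → ℕ) → (∀ i → σ i ≤ 1) →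
                        length (firstSupport r σ) ≡ r ⊓ sum σ
  length-firstSupport {zero}  r       σ σ≤1 = sym (⊓-zeroʳ r)
  length-firstSupport {suc n} zero    σ σ≤1 = refl
  length-firstSupport {suc n} (suc r) σ σ≤1 with σ zero | σ≤1 zero
  ... | zero        | _ = trans (length-map Fin.suc (firstSupport (suc r) (σ ∘ suc)))
                                (length-firstSupport (suc r) (σ ∘ suc) (σ≤1 ∘ suc))
  ... | suc zero    | _ = cong suc (trans (length-map Fin.suc (firstSupport r (σ ∘ suc)))
                                          (length-firstSupport r (σ ∘ suc) (σ≤1 ∘ suc)))
  ... | suc (suc _) | s≤s ()

  length-firstSupport≤∑ : ∀ {n} r (σ τ : Fin n → ℕ) → All (λ i → τ i ≡ 1) (firstSupport r σ) →
                          length (firstSupport r σ) ≤ ∑[ i < n ] (σ i * τ i)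
  length-firstSupport≤∑ {zero}  r       σ τ _ = z≤n
  length-firstSupport≤∑ {suc n} zero    σ τ _ = z≤n
  length-firstSupport≤∑ {suc n} (suc r) σ τ chosen with σ zero
  ... | zero = begin
    length (map suc L)  ≡⟨ length-map Fin.suc L ⟩
    length L            ≤⟨ length-firstSupport≤∑ (suc r) (σ ∘ suc) (τ ∘ suc) (map⁻ chosen) ⟩
    S                   ∎
    where
    open ≤-Reasoning
    L : List (Fin n)
    L = firstSupport (suc r) (σ ∘ suc)
    S : ℕ
    S = ∑[ i < n ] (σ (suc i) * τ (suc i))
  ... | suc s with chosen
  ...   | τ₀≡1 ∷ rest = begin
    suc (length (map suc L))  ≡⟨ cong suc (length-map Fin.suc L) ⟩
    suc (length L)            ≤⟨ s≤s (length-firstSupport≤∑ r (σ ∘ suc) (τ ∘ suc) (map⁻ rest)) ⟩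
    suc S                     ≤⟨ s≤s (m≤n+m S (s * 1)) ⟩
    suc s * 1 + S             ≡⟨ cong (λ t → suc s * t + S) τ₀≡1 ⟨
    suc s * τ zero + S        ∎
    where
    open ≤-Reasoning
    L : List (Fin n)
    L = firstSupport r (σ ∘ suc)
    S : ℕ
    S = ∑[ i < n ] (σ (suc i) * τ (suc i))

  -- P need not be decidable, so a maximiser exists only up to double negation.
  ¬¬-maximum : ∀ {a p} {A : Set a} (P : A → Set p) (f : A → ℕ) {N} → (∀ x → f x ≤ N) →
               ∀ {x₀} → P x₀ → ¬ ¬ (∃ λ v → P v × ∀ x → P x → f x ≤ f v)
  ¬¬-maximum P f {N} f≤N {x₀} px₀ noMaximum = climb N px₀ (m≤m+n N (f x₀))
    where
    climb  : ∀ gap {v} → P v → N ≤ gap + f v → ⊥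
    higher : ∀ gap {v x} → f v < f x → P x → N ≤ gap + f v → ⊥

    climb gap {v} pv N≤gap+fv =
      noMaximum (v , pv , λ x px → ≮⇒≥ (λ fv<fx → higher gap fv<fx px N≤gap+fv))

    higher zero    {v} {x} fv<fx px N≤fv = <⇒≱ (<-≤-trans fv<fx (f≤N x)) N≤fv
    higher (suc g) {v} {x} fv<fx px N≤1+g+fv =
      climb g px (≤-trans N≤1+g+fv (≤-trans (≤-reflexive (sym (+-suc g (f v)))) (+-monoʳ-≤ g fv<fx)))

module LinearForms {c ℓ} (F : FiniteField c ℓ) where

  open FiniteField F hiding (zero)
  open CodeDefs F
  open import Algebra.Properties.Ring ring using (-‿distribˡ-*)
  open import Algebra.Properties.Group +-group using (∙-cancelˡ)
  open import Algebra.Solver.Ring.NaturalCoefficients.Default commutativeSemiring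
    using (solve; _:=_; _:+_; _:*_)
  open import Data.Nat using (zero; suc; _<_; s≤s)
  open import Data.Nat.Properties using (≤-trans; ≤-reflexive)
  open import Data.Fin using (zero; suc)
  open import Data.Vec.Functional using (_∷_; tail)
  open import Data.List using (List; length; map)
  open import Data.List.Properties using (length-map)
  open import Data.List.Relation.Unary.All as All using (All)
  open import Data.List.Relation.Unary.All.Properties using (─⁻; map⁻; ¬Any⇒All¬)
  open import Data.List.Relation.Unary.Any as Any using (any?; _─_)
  open import Data.List.Relation.Unary.Any.Properties using (lookup-result)
  open import Data.Product using (∃; _×_; _,_; proj₁; proj₂)
  open import Function using (_∘_; _⇔_; mk⇔; Equivalence)
  open import Relation.Nullary using (¬_; ¬?; yes; no)
  open import Relation.Nullary.Decidable using (decidable-stable)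
  open import Relation.Binary.PropositionalEquality as ≡ using ()
  open import Relation.Binary.Reasoning.Setoid setoid
  open Counting using (length-─)

  infixl 6 _⊕_
  infixr 7 _·_

  _⊕_ : ∀ {k} → Vec k → Vec k → Vec k
  (x ⊕ y) j = x j + y j

  _·_ : ∀ {k} → Carrier → Vec k → Vec k
  (t · y) j = t * y j

  dot-comm : ∀ k (x y : Vec k) → dot k x y ≈ dot k y x
  dot-comm zero    x y = refl
  dot-comm (suc k) x y = +-cong (*-comm _ _) (dot-comm k (tail x) (tail y))

  dot-zeroˡ : ∀ k {x : Vec k} (y : Vec k) → IsZero x → dot k x y ≈ 0#
  dot-zeroˡ zero    y x≈0 = refl
  dot-zeroˡ (suc k) y x≈0 = begin
    _                 ≈⟨ +-cong (*-congʳ (x≈0 zero)) (dot-zeroˡ k (tail y) (x≈0 ∘ suc)) ⟩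
    0# * y zero + 0#  ≈⟨ +-identityʳ _ ⟩
    0# * y zero       ≈⟨ zeroˡ _ ⟩
    0#                ∎

  dot-linearˡ : ∀ k (x y p : Vec k) t → dot k (x ⊕ t · y) p ≈ dot k x p + t * dot k y p
  dot-linearˡ zero    x y p t = sym (trans (+-identityˡ _) (zeroʳ t))
  dot-linearˡ (suc k) x y p t = begin
    (x₀ + t * y₀) * p₀ + dot k (tail x ⊕ t · tail y) (tail p)
      ≈⟨ +-congˡ (dot-linearˡ k (tail x) (tail y) (tail p) t) ⟩
    (x₀ + t * y₀) * p₀ + (X + t * Y)
      ≈⟨ solve 6 (λ x₀ y₀ p₀ t X Y → (x₀ :+ t :* y₀) :* p₀ :+ (X :+ t :* Y)
                                   := (x₀ :* p₀ :+ X) :+ t :* (y₀ :* p₀ :+ Y)) refl x₀ y₀ p₀ t X Y ⟩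
    (x₀ * p₀ + X) + t * (y₀ * p₀ + Y)
      ∎
    where
    x₀ y₀ p₀ X Y : Carrier
    x₀ = x zero
    y₀ = y zero
    p₀ = p zero
    X = dot k (tail x) (tail p)
    Y = dot k (tail y) (tail p)

  dot-linearʳ : ∀ k (w x y : Vec k) t → dot k w (x ⊕ t · y) ≈ dot k w x + t * dot k w y
  dot-linearʳ k w x y t = begin
    dot k w (x ⊕ t · y)        ≈⟨ dot-comm k w _ ⟩
    dot k (x ⊕ t · y) w        ≈⟨ dot-linearˡ k x y w t ⟩
    dot k x w + t * dot k y w  ≈⟨ +-cong (dot-comm k x w) (*-congˡ (dot-comm k y w)) ⟩
    dot k w x + t * dot k w y  ∎

  dot-add-vanishing : ∀ {k} {y p : Vec k} → dot k y p ≈ 0# → ∀ x t → dot k (x ⊕ t · y) p ≈ dot k x p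
  dot-add-vanishing {k} {y} {p} yp≈0 x t = begin
    dot k (x ⊕ t · y) p        ≈⟨ dot-linearˡ k x y p t ⟩
    dot k x p + t * dot k y p  ≈⟨ +-congˡ (trans (*-congˡ yp≈0) (zeroʳ t)) ⟩
    dot k x p + 0#             ≈⟨ +-identityʳ _ ⟩
    dot k x p                  ∎

  *-cancelˡ-≉0 : ∀ {a x y} → ¬ a ≈ 0# → a * x ≈ a * y → x ≈ y
  *-cancelˡ-≉0 {a} {x} {y} a≉0 ax≈ay = begin
    x              ≈⟨ sym (*-identityˡ x) ⟩
    1# * x         ≈⟨ *-congʳ (sym a*a⁻¹≈1) ⟩
    (a * a⁻¹) * x  ≈⟨ solve 3 (λ a a⁻¹ x → (a :* a⁻¹) :* x := a⁻¹ :* (a :* x)) refl a a⁻¹ x ⟩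
    a⁻¹ * (a * x)  ≈⟨ *-congˡ ax≈ay ⟩
    a⁻¹ * (a * y)  ≈⟨ solve 3 (λ a a⁻¹ y → a⁻¹ :* (a :* y) := (a :* a⁻¹) :* y) refl a a⁻¹ y ⟩
    (a * a⁻¹) * y  ≈⟨ *-congʳ a*a⁻¹≈1 ⟩
    1# * y         ≈⟨ *-identityˡ y ⟩
    y              ∎
    where
    a⁻¹ : Carrier
    a⁻¹ = proj₁ (inverse a a≉0)
    a*a⁻¹≈1 : a * a⁻¹ ≈ 1#
    a*a⁻¹≈1 = proj₂ (inverse a a≉0)

  affine-root : ∀ {a} → ¬ a ≈ 0# → ∀ b → ∃ λ r → ∀ t → (b + t * a ≈ 0#) ⇔ (t ≈ r)
  affine-root {a} a≉0 b = r , λ t → mk⇔ (unique t) (λ t≈r → trans (+-congˡ (*-congʳ t≈r)) root)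
    where
    a⁻¹ r : Carrier
    a⁻¹ = proj₁ (inverse a a≉0)
    r = - (b * a⁻¹)
    root : b + r * a ≈ 0#
    root = begin
      b + - (b * a⁻¹) * a    ≈⟨ +-congˡ (sym (-‿distribˡ-* (b * a⁻¹) a)) ⟩
      b + - (b * a⁻¹ * a)
        ≈⟨ +-congˡ (-‿cong (solve 3 (λ a a⁻¹ b → b :* a⁻¹ :* a := b :* (a :* a⁻¹)) refl a a⁻¹ b)) ⟩
      b + - (b * (a * a⁻¹))  ≈⟨ +-congˡ (-‿cong (trans (*-congˡ (proj₂ (inverse a a≉0))) (*-identityʳ b))) ⟩
      b + - b                ≈⟨ -‿inverseʳ b ⟩
      0#                     ∎
    unique : ∀ t → b + t * a ≈ 0# → t ≈ r
    unique t root′ =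
      *-cancelˡ-≉0 a≉0 (trans (*-comm a t) (trans (∙-cancelˡ b _ _ (trans root′ (sym root))) (*-comm r a)))

  pencil-root : ∀ {k} {x p : Vec k} → ¬ dot k x p ≈ 0# → ∀ y →
                ∃ λ r → ∀ t → (dot k (y ⊕ t · x) p ≈ 0#) ⇔ (t ≈ r)
  pencil-root {k} {x} {p} xp≉0 y with affine-root xp≉0 (dot k y p)
  ... | r , root⇔ = r , λ t → mk⇔
    (λ e → Equivalence.to (root⇔ t) (trans (sym (dot-linearˡ k y x p t)) e))
    (λ t≈r → trans (dot-linearˡ k y x p t) (Equivalence.from (root⇔ t) t≈r))

  pencil-through : ∀ {k} {x p : Vec k} → dot k x p ≈ 0# → ∀ y t →
                   (dot k (y ⊕ t · x) p ≈ 0#) ⇔ (dot k y p ≈ 0#)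
  pencil-through xp≈0 y t =
    mk⇔ (trans (sym (dot-add-vanishing xp≈0 y t))) (trans (dot-add-vanishing xp≈0 y t))

  combination-through : ∀ {k} {x y p : Vec k} → dot k x p ≈ 0# → dot k y p ≈ 0# → ∀ t → dot k (x ⊕ t · y) p ≈ 0#
  combination-through {x = x} xp≈0 yp≈0 t = trans (dot-add-vanishing yp≈0 x t) xp≈0

  combination-nonzero : ∀ {k} {x y p : Vec k} → ¬ IsZero x → dot k x p ≈ 0# → ¬ dot k y p ≈ 0# →
                        ∀ t → ¬ IsZero (x ⊕ t · y)
  combination-nonzero {k} {x} {y} {p} x≢0 xp≈0 yp≉0 t x+ty≈0 = x≢0 λ j → begin
    x j            ≈⟨ sym (+-identityʳ (x j)) ⟩
    x j + 0#       ≈⟨ +-congˡ (sym (trans (*-congʳ t≈0) (zeroˡ (y j)))) ⟩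
    x j + t * y j  ≈⟨ x+ty≈0 j ⟩
    0#             ∎
    where
    t≈0 : t ≈ 0#
    t≈0 = *-cancelˡ-≉0 yp≉0 (begin
      dot k y p * t              ≈⟨ *-comm _ t ⟩
      t * dot k y p              ≈⟨ sym (+-identityˡ _) ⟩
      0# + t * dot k y p         ≈⟨ +-congʳ (sym xp≈0) ⟩
      dot k x p + t * dot k y p  ≈⟨ sym (dot-linearˡ k x y p t) ⟩
      dot k (x ⊕ t · y) p        ≈⟨ dot-zeroˡ k p x+ty≈0 ⟩
      0#                         ≈⟨ sym (zeroʳ _) ⟩
      dot k y p * 0#             ∎)

  nontrivial-solution : ∀ k (ys : List (Vec k)) → length ys < k →
                        ∃ λ w → ¬ IsZero w × All (λ y → dot k w y ≈ 0#) ys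
  nontrivial-solution zero    ys ()
  nontrivial-solution (suc k) ys (s≤s |ys|≤k) with any? (λ y → ¬? (y zero ≟ 0#)) ys
  ... | no noPivot =
    e₀ , (λ e₀≈0 → 0≉1 (sym (e₀≈0 zero))) ,
    All.map (λ {y} ¬y₀≉0 → e₀⊥ y (decidable-stable (y zero ≟ 0#) ¬y₀≉0)) (¬Any⇒All¬ ys noPivot)
    where
    e₀ : Vec (suc k)
    e₀ = 1# ∷ λ _ → 0#
    e₀⊥ : ∀ y → y zero ≈ 0# → dot (suc k) e₀ y ≈ 0#
    e₀⊥ y y₀≈0 = begin
      1# * y zero + dot k (λ _ → 0#) (tail y)
        ≈⟨ +-cong (trans (*-identityˡ _) y₀≈0) (dot-zeroˡ k (tail y) (λ _ → refl)) ⟩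
      0# + 0#
        ≈⟨ +-identityʳ 0# ⟩
      0# ∎
  ... | yes pivot =
    w , (λ w≈0 → w′≢0 (w≈0 ∘ suc)) , ─⁻ pivot w⊥y* (All.map (λ {y} → trans (w≈project y)) (map⁻ w′⊥))
    where
    -- Gaussian elimination of the first coordinate against the equation y*, whose head is invertible.
    y* : Vec (suc k)
    y* = Any.lookup pivot
    c⁻¹ : Carrier
    c⁻¹ = proj₁ (inverse (y* zero) (lookup-result pivot))
    project : Vec (suc k) → Vec k
    project y = tail y ⊕ - (y zero * c⁻¹) · tail y*
    rest : List (Vec k)
    rest = map project (ys ─ pivot)
    |rest|<k : length rest < k
    |rest|<k = ≤-trans (≤-reflexive (≡.trans (≡.cong suc (length-map project (ys ─ pivot))) (length-─ pivot))) |ys|≤k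
    solution : ∃ λ w′ → ¬ IsZero w′ × All (λ y → dot k w′ y ≈ 0#) rest
    solution = nontrivial-solution k rest |rest|<k
    w′ : Vec k
    w′ = proj₁ solution
    w′≢0 : ¬ IsZero w′
    w′≢0 = proj₁ (proj₂ solution)
    w′⊥ : All (λ y → dot k w′ y ≈ 0#) rest
    w′⊥ = proj₂ (proj₂ solution)
    D : Carrier
    D = dot k w′ (tail y*)
    w : Vec (suc k)
    w = - (D * c⁻¹) ∷ w′
    w≈project : ∀ y → dot (suc k) w y ≈ dot k w′ (project y)
    w≈project y = begin
      - (D * c⁻¹) * y zero + dot k w′ (tail y)  ≈⟨ +-comm _ _ ⟩
      dot k w′ (tail y) + - (D * c⁻¹) * y zero  ≈⟨ +-congˡ (sym (-‿distribˡ-* _ _)) ⟩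
      dot k w′ (tail y) + - (D * c⁻¹ * y zero)
        ≈⟨ +-congˡ (-‿cong (solve 3 (λ D c⁻¹ y₀ → D :* c⁻¹ :* y₀ := y₀ :* c⁻¹ :* D) refl D c⁻¹ (y zero))) ⟩
      dot k w′ (tail y) + - (y zero * c⁻¹ * D)  ≈⟨ +-congˡ (-‿distribˡ-* _ _) ⟩
      dot k w′ (tail y) + - (y zero * c⁻¹) * D  ≈⟨ sym (dot-linearʳ k w′ (tail y) (tail y*) _) ⟩
      dot k w′ (project y)                      ∎
    w⊥y* : dot (suc k) w y* ≈ 0#
    w⊥y* = begin
      - (D * c⁻¹) * y* zero + D    ≈⟨ +-congʳ (sym (-‿distribˡ-* _ _)) ⟩
      - (D * c⁻¹ * y* zero) + D
        ≈⟨ +-congʳ (-‿cong (solve 3 (λ D c⁻¹ y₀ → D :* c⁻¹ :* y₀ := D :* (y₀ :* c⁻¹)) refl D c⁻¹ (y* zero))) ⟩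
      - (D * (y* zero * c⁻¹)) + D
        ≈⟨ +-congʳ (-‿cong (trans (*-congˡ (proj₂ (inverse (y* zero) (lookup-result pivot)))) (*-identityʳ D))) ⟩
      - D + D                      ≈⟨ -‿inverseˡ D ⟩
      0#                           ∎

module Pencils {c ℓ} (F : FiniteField c ℓ) where

  open FiniteField F using (Carrier; _≈_; _≟_; 0#; sym; trans; elements; complete; distinct; order)
  open CodeDefs F
  open LinearForms F using (_⊕_; _·_; pencil-root; pencil-through)
  open Counting
  open import Data.Nat using (ℕ; suc; _+_; _*_; _≤_)
  open import Data.Nat.Properties using (*-identityˡ; *-identityʳ; *-zeroʳ; *-distribˡ-+; *-mono-≤; +-monoʳ-≤)
  open import Data.Nat.Solver using (module +-*-Solver)
  open import Data.Fin using (Fin)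
  open import Data.List using ([]; _∷_; length; lookup)
  open import Data.List.Relation.Unary.All as All using (All; []; _∷_)
  open import Data.List.Relation.Unary.All.Properties using (All¬⇒¬Any)
  open import Data.List.Relation.Unary.Any as Any using (Any; here; there)
  open import Data.List.Relation.Unary.AllPairs using (AllPairs; _∷_)
  open import Data.Product using (_,_)
  open import Relation.Nullary using (¬_; yes; no)
  open import Relation.Binary.PropositionalEquality as ≡ using (_≡_; cong; cong₂)
  open ≡.≡-Reasoning

  q : ℕ
  q = order

  element : Fin q → Carrier
  element = lookup elements

  ∑-lookup-≟-absent : ∀ {x} xs → All (λ y → ¬ y ≈ x) xs → ∑[ j < length xs ] 𝟙 (lookup xs j ≟ x) ≡ 0
  ∑-lookup-≟-absent []       []           = ≡.refl
  ∑-lookup-≟-absent (y ∷ ys) (y≉x ∷ ys≉x) = cong₂ _+_ (𝟙-no (y ≟ _) y≉x) (∑-lookup-≟-absent ys ys≉x)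

  ∑-lookup-≟-unique : ∀ {x} xs → AllPairs (λ y z → ¬ y ≈ z) xs → Any (x ≈_) xs →
                      ∑[ j < length xs ] 𝟙 (lookup xs j ≟ x) ≡ 1
  ∑-lookup-≟-unique (y ∷ ys) (y≉ys ∷ _) (here x≈y) =
    cong₂ _+_ (𝟙-yes (y ≟ _) (sym x≈y))
              (∑-lookup-≟-absent ys (All.map (λ y≉z z≈x → y≉z (trans (sym x≈y) (sym z≈x))) y≉ys))
  ∑-lookup-≟-unique (y ∷ ys) (y≉ys ∷ ys-distinct) (there x∈ys) =
    cong₂ _+_ (𝟙-no (y ≟ _) (λ y≈x → All¬⇒¬Any y≉ys (Any.map (trans y≈x) x∈ys)))
              (∑-lookup-≟-unique ys ys-distinct x∈ys)

  ∑-element-≟ : ∀ x → ∑[ j < q ] 𝟙 (element j ≟ x) ≡ 1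
  ∑-element-≟ x = ∑-lookup-≟-unique elements distinct (complete x)

  incidence : ∀ {k} → Vec k → Vec k → ℕ
  incidence {k} x p = 𝟙 (dot k x p ≟ 0#)

  -- A point off H_x lies on exactly one hyperplane y + t x of the pencil; a point on H_x lies on
  -- all of them or on none.
  pencil-incidences : ∀ {k} (x y p : Vec k) →
    incidence x p + ∑[ t < q ] incidence (y ⊕ element t · x) p ≡ 1 + q * (incidence x p * incidence y p)
  pencil-incidences {k} x y p with dot k x p ≟ 0#
  ... | yes xp≈0 = cong suc (begin
    ∑[ t < q ] incidence (y ⊕ element t · x) p
      ≡⟨ sum-cong-≗ (λ t → 𝟙-cong (pencil-through xp≈0 y (element t))
                                   (dot k (y ⊕ element t · x) p ≟ 0#) (dot k y p ≟ 0#)) ⟩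
    ∑[ t < q ] incidence y p
      ≡⟨ ∑-const q (incidence y p) ⟩
    q * incidence y p
      ≡⟨ cong (q *_) (*-identityˡ (incidence y p)) ⟨
    q * (1 * incidence y p)
      ∎)
  ... | no xp≉0 with pencil-root xp≉0 y
  ...   | r , root⇔ = begin
    ∑[ t < q ] incidence (y ⊕ element t · x) p
      ≡⟨ sum-cong-≗ (λ t → 𝟙-cong (root⇔ (element t)) (dot k (y ⊕ element t · x) p ≟ 0#) (element t ≟ r)) ⟩
    ∑[ t < q ] 𝟙 (element t ≟ r)
      ≡⟨ ∑-element-≟ r ⟩
    1
      ≡⟨ cong suc (*-zeroʳ q) ⟨
    1 + q * 0
      ∎

  pencil-bound : ∀ {X Y B} (f : Fin q → ℕ) → X + sum f ≡ Y → (∀ t → f t ≤ B) → Y ≤ X + q * B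
  pencil-bound {X} f ≡.refl f≤B = +-monoʳ-≤ X (∑-bounded f≤B)

  module WeightedMeets {n k} (G : ProjectiveSystem n k) where

    open ProjectiveSystem G

    infixl 7 _∩_
    _∩_ : (Fin n → ℕ) → Vec k → Fin n → ℕ
    (ρ ∩ x) i = ρ i * incidence x (point i)

    weightedMeet : (Fin n → ℕ) → Vec k → ℕ
    weightedMeet ρ x = sum (ρ ∩ x)

    allPoints : Fin n → ℕ
    allPoints _ = 1

    meet≡weightedMeet : ∀ x → meet x ≡ weightedMeet allPoints x
    meet≡weightedMeet x = ≡.trans (count≡∑𝟙 n (λ i → dot k x (point i) ≟ 0#))
                                  (sum-cong-≗ (λ i → ≡.sym (*-identityˡ (incidence x (point i)))))

    ∑-allPoints : sum allPoints ≡ n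
    ∑-allPoints = ≡.trans (∑-const n 1) (*-identityʳ n)

    ∩-≤1 : ∀ {ρ} → (∀ i → ρ i ≤ 1) → ∀ x i → (ρ ∩ x) i ≤ 1
    ∩-≤1 ρ≤1 x i = *-mono-≤ (ρ≤1 i) (𝟙≤1 (dot k x (point i) ≟ 0#))

    pencil-identity : ∀ ρ x y →
      weightedMeet ρ x + ∑[ t < q ] weightedMeet ρ (y ⊕ element t · x) ≡ sum ρ + q * weightedMeet (ρ ∩ x) y
    pencil-identity ρ x y = begin
      sum (ρ ∩ x) + ∑[ t < q ] ∑[ i < n ] (ρ i * I t i)  ≡⟨ cong (sum (ρ ∩ x) +_) (∑-comm (λ t i → ρ i * I t i)) ⟩
      sum (ρ ∩ x) + ∑[ i < n ] ∑[ t < q ] (ρ i * I t i)  ≡⟨ ∑-distrib-+ (ρ ∩ x) _ ⟨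
      ∑[ i < n ] ((ρ ∩ x) i + ∑[ t < q ] (ρ i * I t i))  ≡⟨ sum-cong-≗ per-point ⟩
      ∑[ i < n ] (ρ i + q * (ρ ∩ x ∩ y) i)               ≡⟨ ∑-distrib-+ ρ _ ⟩
      sum ρ + ∑[ i < n ] (q * (ρ ∩ x ∩ y) i)             ≡⟨ cong (sum ρ +_) (*-distribˡ-sum q (ρ ∩ x ∩ y)) ⟨
      sum ρ + q * weightedMeet (ρ ∩ x) y                 ∎
      where
      I : Fin q → Fin n → ℕ
      I t i = incidence (y ⊕ element t · x) (point i)
      per-point : ∀ i → (ρ ∩ x) i + ∑[ t < q ] (ρ i * I t i) ≡ ρ i + q * (ρ ∩ x ∩ y) i
      per-point i = begin
        ρ i * ix + ∑[ t < q ] (ρ i * I t i)  ≡⟨ cong (ρ i * ix +_) (*-distribˡ-sum (ρ i) (λ t → I t i)) ⟨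
        ρ i * ix + ρ i * ∑[ t < q ] I t i    ≡⟨ *-distribˡ-+ (ρ i) ix _ ⟨
        ρ i * (ix + ∑[ t < q ] I t i)        ≡⟨ cong (ρ i *_) (pencil-incidences x y (point i)) ⟩
        ρ i * (1 + q * (ix * iy))
          ≡⟨ solve 4 (λ ρ q a b → ρ :* (con 1 :+ q :* (a :* b)) := ρ :+ q :* (ρ :* a :* b)) ≡.refl (ρ i) q ix iy ⟩
        ρ i + q * (ρ i * ix * iy)            ∎
        where
        open +-*-Solver
        ix = incidence x (point i)
        iy = incidence y (point i)
module FlagArithmetic where

  open import Data.Nat
  open import Data.Nat.Properties
  open import Data.Nat.Solver using (module +-*-Solver)
  open import Data.Product using (_,_)
  open import Data.Sum using (inj₁; inj₂)
  open import Relation.Nullary using (yes; no; contradiction)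
  open import Relation.Binary.PropositionalEquality
  open +-*-Solver using (solve; _:=_; _:+_; _:*_; con)

  -- For a projective system of n points: M₁ points on a heaviest hyperplane H, M₂ on a heaviest
  -- codimension-2 subspace S ⊂ H, and M₃ on a codimension-3 subspace of S through min(k-3, M₂) of them.
  record FlagCounts (n k d q : ℕ) : Set where
    field
      M₁ M₂ M₃ : ℕ
      n≡d+M₁  : n ≡ d + M₁
      1≤d     : 1 ≤ d
      pencil₁ : n + q * M₂ ≤ M₁ + q * M₁
      pencil₂ : M₁ + q * M₃ ≤ M₂ + q * M₂
      codim₃  : (k ∸ 3) ⊓ M₂ ≤ M₃

  r⊓m≤l<m⇒r≤l : ∀ {r m l} → r ⊓ m ≤ l → l < m → r ≤ l
  r⊓m≤l<m⇒r≤l {r} {m} r⊓m≤l l<m with ≤-total r m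
  ... | inj₁ r≤m = subst (_≤ _) (m≤n⇒m⊓n≡m r≤m) r⊓m≤l
  ... | inj₂ m≤r = contradiction (subst (_≤ _) (m≥n⇒m⊓n≡n m≤r) r⊓m≤l) (<⇒≱ l<m)

  pencil₁⇒d+qM₂≤qM₁ : ∀ {n d q M₁ M₂} → n ≡ d + M₁ → n + q * M₂ ≤ M₁ + q * M₁ → d + q * M₂ ≤ q * M₁
  pencil₁⇒d+qM₂≤qM₁ {d = d} {q} {M₁} {M₂} refl h = +-cancelˡ-≤ M₁ _ _ (begin
    M₁ + (d + q * M₂)   ≡⟨ solve 4 (λ M₁ d q M₂ → M₁ :+ (d :+ q :* M₂) := d :+ M₁ :+ q :* M₂) refl M₁ d q M₂ ⟩
    d + M₁ + q * M₂     ≤⟨ h ⟩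
    M₁ + q * M₁         ∎)
    where open ≤-Reasoning

  d+qM₂≤qM₁⇒M₂<M₁ : ∀ {d q M₁ M₂} → 1 ≤ d → d + q * M₂ ≤ q * M₁ → M₂ < M₁
  d+qM₂≤qM₁⇒M₂<M₁ {q = q} {M₁} {M₂} 1≤d h = *-cancelˡ-< q M₂ M₁ (≤-trans (+-monoˡ-≤ (q * M₂) 1≤d) h)

  pencil₂⇒M₃<M₂ : ∀ {q M₁ M₂ M₃} → M₂ < M₁ → M₁ + q * M₃ ≤ M₂ + q * M₂ → M₃ < M₂
  pencil₂⇒M₃<M₂ {q} {M₁} {M₂} {M₃} M₂<M₁ h =
    *-cancelˡ-< q M₃ M₂ (+-cancelˡ-< M₂ _ _ (<-≤-trans (+-monoˡ-< (q * M₃) M₂<M₁) h))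

  excess⇒α<B : ∀ {d q A B} α → 1 ≤ d → d ≤ q * A → A ≤ q * B → α * (q * q + q) < d + q → α < B
  excess⇒α<B {d} {q} {A} {B} α 1≤d d≤qA A≤qB hα with α <? B
  ... | yes α<B = α<B
  ... | no  α≮B = contradiction hα (≤⇒≯ (too-small α (≮⇒≥ α≮B)))
    where
    d≤qqB : d ≤ q * q * B
    d≤qqB = ≤-trans d≤qA (≤-trans (*-monoʳ-≤ q A≤qB) (≤-reflexive (sym (*-assoc q q B))))
    too-small : ∀ α → B ≤ α → d + q ≤ α * (q * q + q)
    too-small zero    B≤0 = contradiction (≤-trans 1≤d (≤-trans d≤qqB qqB≤0)) λ ()
      where
      qqB≤0 : q * q * B ≤ 0
      qqB≤0 = ≤-trans (*-monoʳ-≤ (q * q) B≤0) (≤-reflexive (*-zeroʳ (q * q)))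
    too-small (suc α) B≤α = begin
      d + q                         ≤⟨ +-mono-≤ (≤-trans d≤qqB (*-monoʳ-≤ (q * q) B≤α)) (m≤n*m q (suc α)) ⟩
      q * q * suc α + suc α * q     ≡⟨ solve 2 (λ q a → q :* q :* a :+ a :* q := a :* (q :* q :+ q)) refl q (suc α) ⟩
      suc α * (q * q + q)           ∎
      where open ≤-Reasoning

  flag-inequalities⇒bound : ∀ {d q M₁ M₂ r α} → 1 ≤ d → r ≤ M₂ → M₂ ≤ M₁ →
                            d + q * M₂ ≤ q * M₁ → M₁ + q * r ≤ M₂ + q * M₂ →
                            α * (q * q + q) < d + q → d + q * (suc r + α) ≤ q * M₁
  flag-inequalities⇒bound {d} {q} {r = r} {α} 1≤d r≤M₂ M₂≤M₁ h₁ h₂ hα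
    with m≤n⇒∃[o]m+o≡n r≤M₂ | m≤n⇒∃[o]m+o≡n M₂≤M₁
  ... | B , refl | A , refl = begin
    d + q * (suc r + α)
      ≡⟨ solve 4 (λ d q r α → d :+ q :* (con 1 :+ r :+ α) := q :* r :+ (d :+ q :* (con 1 :+ α))) refl d q r α ⟩
    q * r + (d + q * suc α)
      ≤⟨ +-monoʳ-≤ (q * r) (+-mono-≤ d≤qA (*-monoʳ-≤ q (excess⇒α<B α 1≤d d≤qA A≤qB hα))) ⟩
    q * r + (q * A + q * B)
      ≡⟨ solve 4 (λ q r A B → q :* r :+ (q :* A :+ q :* B) := q :* (r :+ B :+ A)) refl q r A B ⟩
    q * (r + B + A)
      ∎
    where
    open ≤-Reasoning
    d≤qA : d ≤ q * A
    d≤qA = +-cancelˡ-≤ (q * (r + B)) _ _ (begin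
      q * (r + B) + d            ≡⟨ +-comm (q * (r + B)) d ⟩
      d + q * (r + B)            ≤⟨ h₁ ⟩
      q * (r + B + A)            ≡⟨ *-distribˡ-+ q (r + B) A ⟩
      q * (r + B) + q * A        ∎)
    A≤qB : A ≤ q * B
    A≤qB = +-cancelˡ-≤ (r + B + q * r) _ _ (begin
      r + B + q * r + A          ≡⟨ solve 4 (λ r B q A → r :+ B :+ q :* r :+ A := r :+ B :+ A :+ q :* r) refl r B q A ⟩
      r + B + A + q * r          ≤⟨ h₂ ⟩
      r + B + q * (r + B)        ≡⟨ solve 3 (λ r B q → r :+ B :+ q :* (r :+ B) := r :+ B :+ q :* r :+ q :* B) refl r B q ⟩
      r + B + q * r + q * B      ∎)

  flag-bound : ∀ {n k d q α} (C : FlagCounts n k d q) → α * (q * q + q) < d + q →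
               d + q * (suc (k ∸ 3) + α) ≤ q * FlagCounts.M₁ C
  flag-bound {n} {k} {d} {q} C hα =
    flag-inequalities⇒bound 1≤d (<⇒≤ (≤-<-trans r≤M₃ M₃<M₂)) (<⇒≤ M₂<M₁) h₁
                            (≤-trans (+-monoʳ-≤ M₁ (*-monoʳ-≤ q r≤M₃)) pencil₂) hα
    where
    open FlagCounts C
    h₁ : d + q * M₂ ≤ q * M₁
    h₁ = pencil₁⇒d+qM₂≤qM₁ {n} {d} {q} {M₁} {M₂} n≡d+M₁ pencil₁
    M₂<M₁ : M₂ < M₁
    M₂<M₁ = d+qM₂≤qM₁⇒M₂<M₁ {d} {q} 1≤d h₁
    M₃<M₂ : M₃ < M₂
    M₃<M₂ = pencil₂⇒M₃<M₂ {q} M₂<M₁ pencil₂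
    r≤M₃ : k ∸ 3 ≤ M₃
    r≤M₃ = r⊓m≤l<m⇒r≤l codim₃ M₃<M₂

module Flags {c ℓ} (F : FiniteField c ℓ) where

  open FiniteField F using (_≈_; _≟_; 0#)
  open CodeDefs F
  open LinearForms F using (_⊕_; _·_; combination-nonzero; combination-through; nontrivial-solution)
  open Pencils F
  open Counting
  open FlagArithmetic using (FlagCounts)
  open import Data.Nat using (ℕ; _+_; _*_; _∸_; _⊓_; _≤_; _<_; s≤s; z≤n)
  open import Data.Nat.Properties
    using (≤-refl; ≤-reflexive; ≤-trans; +-cancelˡ-≤; +-cancelʳ-≤; *-identityʳ; m⊓n≤m; m+[n∸m]≡n)
  open import Data.Fin using (Fin)
  open import Data.List using (List; []; _∷_; length; map)
  open import Data.List.Properties using (length-map)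
  open import Data.List.Relation.Unary.All as All using (All; _∷_)
  open import Data.List.Relation.Unary.All.Properties using (map⁻)
  open import Data.Product using (∃; _×_; _,_; proj₁; proj₂)
  open import Relation.Nullary using (¬_)
  open import Relation.Nullary.Negation using (¬¬-map)
  open import Relation.Binary.PropositionalEquality as ≡ using (_≡_)

  module Heaviest {n k d} (G : ProjectiveSystem n k) (3≤k : 3 ≤ k)
                  (bounded : ∀ x → ¬ IsZero x → d + ProjectiveSystem.meet G x ≤ n)
                  (u : Vec k) (u≢0 : ¬ IsZero u) (heaviest : d + ProjectiveSystem.meet G u ≡ n) where

    open ProjectiveSystem G
    open WeightedMeets G

    M₁ : ℕ
    M₁ = weightedMeet allPoints u

    n≡d+M₁ : n ≡ d + M₁
    n≡d+M₁ = ≡.trans (≡.sym heaviest) (≡.cong (d +_) (meet≡weightedMeet u))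

    a : Vec k
    a = point (proj₁ (spanning u u≢0))

    ua≉0 : ¬ dot k u a ≈ 0#
    ua≉0 = proj₂ (spanning u u≢0)

    1≤d : 1 ≤ d
    1≤d = +-cancelʳ-≤ (meet u) 1 d
            (≤-trans (count<n n (λ i → dot k u (point i) ≟ 0#) (proj₁ (spanning u u≢0)) ua≉0)
                     (≤-reflexive (≡.sym heaviest)))

    meet≤M₁ : ∀ x → ¬ IsZero x → weightedMeet allPoints x ≤ M₁
    meet≤M₁ x x≢0 = +-cancelˡ-≤ d _ _
      (≡.subst₂ _≤_ (≡.cong (d +_) (meet≡weightedMeet x)) n≡d+M₁ (bounded x x≢0))

    -- The hyperplanes through a point off H cut out on H all of its codimension-2 subspaces.
    Admissible : Vec k → Set ℓ
    Admissible x = ¬ IsZero x × dot k x a ≈ 0#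

    meetInH : Vec k → ℕ
    meetInH = weightedMeet (allPoints ∩ u)

    allPoints∩u∩-≤1 : ∀ x i → (allPoints ∩ u ∩ x) i ≤ 1
    allPoints∩u∩-≤1 = ∩-≤1 (∩-≤1 (λ _ → ≤-refl) u)

    meetInH-≤n : ∀ x → meetInH x ≤ n
    meetInH-≤n x = ≤-trans (∑-bounded (allPoints∩u∩-≤1 x)) (≤-reflexive (*-identityʳ n))

    admissible₀ : ∃ Admissible
    admissible₀ with nontrivial-solution k (a ∷ []) (≤-trans (s≤s (s≤s z≤n)) 3≤k)
    ... | v₀ , v₀≢0 , v₀a≈0 ∷ _ = v₀ , v₀≢0 , v₀a≈0

    level₁ : ∀ {v} → Admissible v → n + q * meetInH v ≤ M₁ + q * M₁
    level₁ {v} (v≢0 , va≈0) =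
      pencil-bound (λ t → weightedMeet allPoints (v ⊕ element t · u))
        (≡.trans (pencil-identity allPoints u v) (≡.cong (_+ q * meetInH v) ∑-allPoints))
        (λ t → meet≤M₁ _ (combination-nonzero v≢0 va≈0 ua≉0 (element t)))

    module Level₂ {v} (v-admissible : Admissible v)
                  (maximal : ∀ x → Admissible x → meetInH x ≤ meetInH v) where

      b : Vec k
      b = point (proj₁ (spanning v (proj₁ v-admissible)))

      vb≉0 : ¬ dot k v b ≈ 0#
      vb≉0 = proj₂ (spanning v (proj₁ v-admissible))

      chosen : List (Fin n)
      chosen = firstSupport (k ∸ 3) (allPoints ∩ u ∩ v)

      |chosen|≡ : length chosen ≡ (k ∸ 3) ⊓ meetInH v
      |chosen|≡ = length-firstSupport (k ∸ 3) (allPoints ∩ u ∩ v) (allPoints∩u∩-≤1 v)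

      |equations|<k : length (a ∷ b ∷ map point chosen) < k
      |equations|<k = ≤-trans (s≤s (s≤s (s≤s |map-chosen|≤k∸3))) (≤-reflexive (m+[n∸m]≡n 3≤k))
        where
        |map-chosen|≤k∸3 : length (map point chosen) ≤ k ∸ 3
        |map-chosen|≤k∸3 = ≤-trans (≤-reflexive (≡.trans (length-map point chosen) |chosen|≡)) (m⊓n≤m _ _)

      solution : ∃ λ w → ¬ IsZero w × All (λ y → dot k w y ≈ 0#) (a ∷ b ∷ map point chosen)
      solution = nontrivial-solution k (a ∷ b ∷ map point chosen) |equations|<k

      w : Vec k
      w = proj₁ solution

      w⊥ : All (λ y → dot k w y ≈ 0#) (a ∷ b ∷ map point chosen)
      w⊥ = proj₂ (proj₂ solution)

      pencil-admissible : ∀ t → Admissible (w ⊕ element t · v)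
      pencil-admissible t =
        combination-nonzero (proj₁ (proj₂ solution)) (All.head (All.tail w⊥)) vb≉0 (element t) ,
        combination-through {x = w} {v} {a} (All.head w⊥) (proj₂ v-admissible) (element t)

      M₃ : ℕ
      M₃ = weightedMeet (allPoints ∩ u ∩ v) w

      pencil₂ : M₁ + q * M₃ ≤ meetInH v + q * meetInH v
      pencil₂ = pencil-bound (λ t → meetInH (w ⊕ element t · v)) (pencil-identity (allPoints ∩ u) v w)
                             (λ t → maximal _ (pencil-admissible t))

      codim₃ : (k ∸ 3) ⊓ meetInH v ≤ M₃
      codim₃ = ≤-trans (≤-reflexive (≡.sym |chosen|≡))
                 (length-firstSupport≤∑ (k ∸ 3) (allPoints ∩ u ∩ v) (λ i → incidence w (point i))
                   (All.map (λ {i} → 𝟙-yes (dot k w (point i) ≟ 0#)) (map⁻ (All.tail (All.tail w⊥)))))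

  counts : ∀ {n k d} (G : ProjectiveSystem n k) → HasMinDistance G d → 3 ≤ k → ¬ ¬ FlagCounts n k d q
  counts G (bounded , u , u≢0 , heaviest) 3≤k =
    ¬¬-map flag (¬¬-maximum Admissible meetInH meetInH-≤n (proj₂ admissible₀))
    where
    open Heaviest G 3≤k bounded u u≢0 heaviest
    flag : (∃ λ v → Admissible v × ∀ x → Admissible x → meetInH x ≤ meetInH v) → FlagCounts _ _ _ q
    flag (v , v-admissible , maximal) = record
      { M₁ = M₁ ; M₂ = meetInH v ; M₃ = M₃ ; n≡d+M₁ = n≡d+M₁ ; 1≤d = 1≤d
      ; pencil₁ = level₁ v-admissible ; pencil₂ = pencil₂ ; codim₃ = codim₃ }
      where open Level₂ v-admissible maximal

open import Level using (Level)
open import Data.Nat using (ℕ; _≥_)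
open import Data.Integer using (ℤ; +_; _+_; _-_; _*_; _≤_; _<_)
open import Data.Product using (_×_)
open import Relation.Binary.PropositionalEquality using (_≡_)

import Data.Nat as ℕ
import Data.Nat.Properties as ℕ
import Data.Integer as ℤ
import Data.Integer.Properties as ℤ
open import Data.Integer.Solver using (module +-*-Solver)
open import Data.Product using (_,_)
open import Relation.Nullary.Decidable using (decidable-stable)
open import Relation.Nullary.Negation using (¬¬-map)
open import Relation.Binary.PropositionalEquality using (refl; sym; trans; cong; cong₂; module ≡-Reasoning)
open +-*-Solver using (solve; _:=_; _:+_; _:-_; _:*_; con)
open FlagArithmetic using (FlagCounts; flag-bound)

hypothesis-in-ℕ : ∀ {α q d} → + α * (+ q * + q + + q) - + q < + d →
                  α ℕ.* (q ℕ.* q ℕ.+ q) ℕ.< d ℕ.+ q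
hypothesis-in-ℕ {α} {q} {d} h = ℤ.drop‿+<+ (begin-strict
  + (α ℕ.* (q ℕ.* q ℕ.+ q))              ≡⟨ ℤ.pos-* α _ ⟩
  + α * + (q ℕ.* q ℕ.+ q)                ≡⟨ cong (+ α *_) (trans (ℤ.pos-+ (q ℕ.* q) q) (cong (_+ + q) (ℤ.pos-* q q))) ⟩
  + α * (+ q * + q + + q)                ≡⟨ solve 2 (λ x q → x := x :- q :+ q) refl (+ α * (+ q * + q + + q)) (+ q) ⟩
  + α * (+ q * + q + + q) - + q + + q    <⟨ ℤ.+-monoˡ-< (+ q) h ⟩
  + d + + q                              ≡⟨ ℤ.pos-+ d q ⟨
  + (d ℕ.+ q)                            ∎)
  where open ℤ.≤-Reasoning

bound-in-ℤ : ∀ {n k d q α M} s → n ≡ d ℕ.+ M → 3 ℕ.≤ k →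
             d ℕ.+ q ℕ.* (ℕ.suc (k ℕ.∸ 3) ℕ.+ α) ℕ.≤ q ℕ.* M →
             s ≡ + n - + k + + 1 - + d → + n ≤ (s + + 1 - + α) * (+ q + + 1) + + k - + 2 + + α
bound-in-ℤ {d = d} {q} {α} {M} s refl 3≤k h refl with ℕ.m≤n⇒∃[o]m+o≡n 3≤k | ℕ.m≤n⇒∃[o]m+o≡n h
... | r , refl | X , excess = ℤ.≤-trans (ℤ.i≤i+j (+ (d ℕ.+ M)) (+ X)) (ℤ.≤-reflexive (begin
  + (d ℕ.+ M) + + X
    ≡⟨ cong (_+ + X) (ℤ.pos-+ d M) ⟩
  (D + Mᶻ) + + X
    ≡⟨ solve 3 (λ Y T X → Y :+ X := Y :+ ((T :+ X) :- T)) refl (D + Mᶻ) T (+ X) ⟩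
  (D + Mᶻ) + ((T + + X) - T)
    ≡⟨ cong (λ z → (D + Mᶻ) + (z - T)) excessᶻ ⟩
  (D + Mᶻ) + (Q * Mᶻ - T)
    ≡⟨ solve 5 (λ D M R A Q → (D :+ M) :+ (Q :* M :- (D :+ Q :* (con (+ 1) :+ R :+ A)))
                              := (((D :+ M) :- (con (+ 3) :+ R) :+ con (+ 1) :- D) :+ con (+ 1) :- A) :* (Q :+ con (+ 1))
                                 :+ (con (+ 3) :+ R) :- con (+ 2) :+ A) refl D Mᶻ R A Q ⟩
  (((D + Mᶻ) - (+ 3 + R) + + 1 - D) + + 1 - A) * (Q + + 1) + (+ 3 + R) - + 2 + A
    ≡⟨ cong₂ (λ N K → ((N - K + + 1 - D) + + 1 - A) * (Q + + 1) + K - + 2 + A) (ℤ.pos-+ d M) (ℤ.pos-+ 3 r) ⟨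
  ((+ (d ℕ.+ M) - + (3 ℕ.+ r) + + 1 - D) + + 1 - A) * (Q + + 1) + + (3 ℕ.+ r) - + 2 + A ∎))
  where
  open ≡-Reasoning
  D Mᶻ R A Q T : ℤ
  D = + d
  Mᶻ = + M
  R = + r
  A = + α
  Q = + q
  T = D + Q * (+ 1 + R + A)
  T≡ : + (d ℕ.+ q ℕ.* (ℕ.suc r ℕ.+ α)) ≡ T
  T≡ = trans (ℤ.pos-+ d _) (cong (λ z → D + z) (trans (ℤ.pos-* q _)
         (cong (Q *_) (trans (ℤ.pos-+ (ℕ.suc r) α) (cong (_+ A) (ℤ.pos-+ 1 r))))))
  excessᶻ : T + + X ≡ Q * Mᶻ
  excessᶻ = trans (cong (_+ + X) (sym T≡)) (trans (sym (ℤ.pos-+ _ X)) (trans (cong +_ excess) (ℤ.pos-* q M)))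

mainTheorem12 : ∀ {c ℓ} (F : FiniteField c ℓ) → let q = FiniteField.order F in
    ∀ (n k d : ℕ) (G : CodeDefs.ProjectiveSystem F n k) →
    CodeDefs.HasMinDistance F G d → k ≥ 3 →
    ∀ (s : ℤ) → s ≡ + n - + k + + 1 - + d →
    (∀ (α : ℕ) → + α * (+ q * + q + + q) - + q < + d →
        + n ≤ (s + + 1 - + α) * (+ q + + 1) + + k - + 2 + + α)
    × (+ q * + q < + d → + n ≤ s * (+ q + + 1) + + k - + 1)
mainTheorem12 F n k d G hasMinDistance k≥3 s s≡ = bound , bound-for-d>q²
  where
  q : ℕ
  q = FiniteField.order F
  bound : ∀ α → + α * (+ q * + q + + q) - + q < + d →
          + n ≤ (s + + 1 - + α) * (+ q + + 1) + + k - + 2 + + α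
  bound α hα = decidable-stable (+ n ℤ.≤? _)
    (¬¬-map (λ C → bound-in-ℤ s (FlagCounts.n≡d+M₁ C) k≥3 (flag-bound C (hypothesis-in-ℕ {α} hα)) s≡)
            (Flags.counts F G hasMinDistance k≥3))
  bound-for-d>q² : + q * + q < + d → + n ≤ s * (+ q + + 1) + + k - + 1
  bound-for-d>q² q²<d = ℤ.≤-trans (bound 1 (ℤ.≤-<-trans (ℤ.≤-reflexive α=1) q²<d)) (ℤ.≤-reflexive rhs)
    where
    α=1 : + 1 * (+ q * + q + + q) - + q ≡ + q * + q
    α=1 = solve 1 (λ q → con (+ 1) :* (q :* q :+ q) :- q := q :* q) refl (+ q)
    rhs : (s + + 1 - + 1) * (+ q + + 1) + + k - + 2 + + 1 ≡ s * (+ q + + 1) + + k - + 1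
    rhs = solve 3 (λ s q k → (s :+ con (+ 1) :- con (+ 1)) :* (q :+ con (+ 1)) :+ k :- con (+ 2) :+ con (+ 1)
                             := s :* (q :+ con (+ 1)) :+ k :- con (+ 1)) refl s (+ q) (+ k)
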